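{- Let $n\ge 4$ and let $C_n$ be the cycle on $n$ vertices. If $f=(V_0,V_1,V_2)$ is any $\gamma^{p}_{I}(C_n)$-function, then $V_2=\emptyset$.
   Context: All graphs are finite and simple. A perfect Italian dominating function (PID-function) of a graph $G$ is a function $f:V(G)\to\{0,1,2\}$ such that for every vertex $v$ with $f(v)=0$ we have $\sum_{u\in N(v)}f(u)=2$, where $N(v)$ is the open neighborhood of $v$. Its weight is $\sum_{u\in V(G)}f(u)$. The perfect Italian domination number $\gamma^{p}_{I}(G)$ is the minimum weight of a PID-function of $G$, and a PID-function of weight $\gamma^{p}_{I}(G)$ is called a $\gamma^{p}_{I}(G)$-function. A function $f:V\to\{0,1,2\}$ is written $f=(V_0,V_1,V_2)$ where $V_i=\{v: f(v)=i\}$. -}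

module Defs where

open import Data.Nat using (ℕ; zero; suc; _+_; _*_; _≤_; NonZero)
open import Data.Nat.DivMod using (_%_)
open import Data.Fin using (Fin; toℕ)
open import Data.Bool using (Bool; true; false; _∨_)
open import Data.Vec.Functional using (foldr)
open import Relation.Binary.PropositionalEquality using (_≡_)
open import Relation.Nullary.Decidable using (⌊_⌋)

-- A graph on vertex set Fin n is represented by its boolean adjacency
-- relation (only the cycle C_n is used below, which is simple for n ≥ 3).
Adj : ℕ → Set
Adj n = Fin n → Fin n → Bool

∑ : ∀ {n} → (Fin n → ℕ) → ℕ
∑ g = foldr _+_ 0 g

Fn : ℕ → Set
Fn n = Fin n → Fin 3

weight : ∀ {n} → Fn n → ℕ
weight f = ∑ (λ u → toℕ (f u))

nbSum : ∀ {n} → Adj n → Fn n → Fin n → ℕ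
nbSum G f v = ∑ (λ u → if' (G v u) (toℕ (f u)))
  where
  if' : Bool → ℕ → ℕ
  if' true  k = k
  if' false _ = 0

IsPID : ∀ {n} → Adj n → Fn n → Set
IsPID G f = ∀ v → toℕ (f v) ≡ 0 → nbSum G f v ≡ 2

IsGammaPIDFunction : ∀ {n} → Adj n → Fn n → Set
IsGammaPIDFunction G f = IsPID G f × (∀ g → IsPID G g → weight f ≤ weight g)
  where open import Data.Product using (_×_)

cycAdj : (n : ℕ) → .{{NonZero n}} → Fin n → Fin n → Bool
cycAdj n i j = ⌊ toℕ j Data.Nat.≟ (suc (toℕ i) % n) ⌋ ∨ ⌊ toℕ i Data.Nat.≟ (suc (toℕ j) % n) ⌋

Cycle : (n : ℕ) → .{{NonZero n}} → Adj n
Cycle n = cycAdj n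

module Submission where

open import Defs
open import Data.Nat using (ℕ; _≤_; NonZero)
open import Data.Fin using (Fin; toℕ)
open import Relation.Binary.PropositionalEquality using (_≢_)

import Data.Nat as ℕ
open import Data.Nat using (pred; zero; suc; _+_; _*_; _∸_; _<_; _%_; _/_; z≤n; s≤s)
open import Data.Nat.Properties
  using ( +-0-commutativeMonoid; +-assoc; +-comm; +-identityʳ; *-zeroʳ
        ; +-cancelʳ-≡; +-cancelˡ-≤; +-mono-≤; +-monoʳ-≤; m≤m+n; m+[n∸m]≡n
        ; ≤-reflexive; ≤-trans; <-trans; <⇒≢; <⇒≱; n≢0⇒n>0; m≤n⇒m<n∨m≡n
        ; suc-pred; module ≤-Reasoning )
open import Data.Nat.DivMod
  using (%-distribˡ-+; m%n%n≡m%n; m%n<n; [m+n]%n≡m%n; m<n⇒m%n≡m; m≡m%n+[m/n]*n; n%n≡0)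
open import Data.Nat.Tactic.RingSolver using (solve-∀)
open import Data.Fin using (zero; suc; punchIn; punchOut; fromℕ<)
open import Data.Fin.Properties using (_≟_; punchIn-punchOut; toℕ-fromℕ<; toℕ-injective; toℕ<n)
open import Data.Fin.Permutation using (permutation)
open import Data.Bool using (true; false; T; if_then_else_)
open import Data.Bool.Properties using (T-∨)
open import Data.Sum using (_⊎_; inj₁; inj₂)
open import Data.Sum.Function.Propositional using (_⊎-⇔_)
open import Data.Product using (_,_; proj₁)
open import Data.Empty using (⊥-elim)
open import Function.Bundles using (_⇔_; mk⇔; Equivalence)
open import Function.Construct.Composition using (_⇔-∘_)
open import Relation.Nullary using (does; yes; no; contradiction)
open import Relation.Nullary.Decidable using (⌊_⌋; toWitness; fromWitness)
open import Relation.Binary.PropositionalEquality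
  using (_≡_; refl; sym; trans; cong; cong₂; subst; module ≡-Reasoning)
open import Algebra.Properties.CommutativeMonoid.Sum +-0-commutativeMonoid
  using (sum-cong-≗; ∑-distrib-+; sum-remove; sum-permute)

-- Let f be a PID-function on C_n (n ≥ 4) of weight w.  Give each vertex v
-- the charge 2·f(v) + (f(next v) + f(prev v)).  Every value is counted four
-- times, so the total charge is 4w; and every charge is at least 2 (a
-- vertex of value 0 receives exactly 2), so 4w = 2n + total excess, where
-- the excess of v is its charge minus 2.
--   * The alternating function 1,0,1,0,... is a PID-function with
--     2·weight ≤ n + 1, so a minimum-weight f has total excess ≤ 2.
--   * A vertex v with f(v) = 2 has excess 2 + f(next v) + f(prev v); if
--     f(next v) = 0, the perfect condition forces the pattern 2,0,0,2 along
--     the cycle, and the second 2 is a different vertex since n ≥ 4.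
--     Either way the total excess is at least 3.
-- The file develops finite sums, neighbourhood sums of vertices with two
-- neighbours, the parity bound, the rotation structure of C_n, and then
-- the counting argument above, from which the theorem follows at once.

∑-const : ∀ n c → ∑ {n} (λ _ → c) ≡ n * c
∑-const zero    c = refl
∑-const (suc n) c = cong (c +_) (∑-const n c)

∑-above : ∀ {n} c (t : Fin n → ℕ) → (∀ u → c ≤ t u) →
  ∑ t ≡ n * c + ∑ (λ u → t u ∸ c)
∑-above {n} c t c≤t = begin
  ∑ t                                  ≡⟨ sum-cong-≗ (λ u → sym (m+[n∸m]≡n (c≤t u))) ⟩
  ∑ (λ u → c + (t u ∸ c))              ≡⟨ ∑-distrib-+ (λ _ → c) (λ u → t u ∸ c) ⟩
  ∑ {n} (λ _ → c) + ∑ (λ u → t u ∸ c)  ≡⟨ cong (_+ ∑ (λ u → t u ∸ c)) (∑-const n c) ⟩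
  n * c + ∑ (λ u → t u ∸ c)            ∎
  where open ≡-Reasoning

term≤∑ : ∀ {n} (t : Fin n → ℕ) i → t i ≤ ∑ t
term≤∑ {suc n} t i = subst (t i ≤_) (sym (sum-remove t)) (m≤m+n (t i) _)

terms≤∑ : ∀ {n} (t : Fin n → ℕ) {a b} → a ≢ b → t a + t b ≤ ∑ t
terms≤∑ {suc n} t {a} {b} a≢b = begin
  t a + t b                               ≡⟨ cong (λ j → t a + t j) (punchIn-punchOut a≢b) ⟨
  t a + t (punchIn a (punchOut a≢b))      ≤⟨ +-monoʳ-≤ (t a) (term≤∑ (λ j → t (punchIn a j)) (punchOut a≢b)) ⟩
  t a + ∑ (λ j → t (punchIn a j))         ≡⟨ sum-remove t ⟨
  ∑ t                                     ∎
  where open ≤-Reasoning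

∑-indicator : ∀ {n} (a : Fin n) (g : Fin n → ℕ) →
  ∑ (λ u → if does (u ≟ a) then g u else 0) ≡ g a
∑-indicator {suc n} zero    g =
  trans (cong (g zero +_) (trans (∑-const n 0) (*-zeroʳ n))) (+-identityʳ (g zero))
∑-indicator {suc n} (suc a) g = ∑-indicator a (λ i → g (suc i))

∑-reindex : ∀ {n} (σ τ : Fin n → Fin n) → (∀ y → σ (τ y) ≡ y) → (∀ x → τ (σ x) ≡ x) →
  (g : Fin n → ℕ) → ∑ (λ x → g (σ x)) ≡ ∑ g
∑-reindex σ τ στ τσ g = sym (sum-permute g (permutation σ τ στ τσ))

-- A
-- one-vertex graph isolates the per-vertex summand of nbSum, which
-- depends only on the adjacency bit and the value at that vertex.
nbSum-if : ∀ {n} (G : Adj n) (f : Fn n) v →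
  nbSum G f v ≡ ∑ (λ u → if G v u then toℕ (f u) else 0)
nbSum-if G f v = sum-cong-≗ λ u →
  trans (sym (+-identityʳ _)) (trans (summand (G v u) (f u)) (+-identityʳ _))
  where
  summand : ∀ b (x : Fin 3) →
    nbSum {1} (λ _ _ → b) (λ _ → x) zero ≡ (if b then toℕ x else 0) + 0
  summand true  x = refl
  summand false x = refl

nbSum-two : ∀ {n} (G : Adj n) (f : Fn n) v {a b} → a ≢ b →
  (∀ u → T (G v u) ⇔ (u ≡ a ⊎ u ≡ b)) →
  nbSum G f v ≡ toℕ (f a) + toℕ (f b)
nbSum-two {n} G f v {a} {b} a≢b nbrs = begin
  nbSum G f v                         ≡⟨ nbSum-if G f v ⟩
  ∑ (λ u → if G v u then g u else 0)  ≡⟨ sum-cong-≗ split ⟩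
  ∑ (λ u → δ a u + δ b u)             ≡⟨ ∑-distrib-+ (δ a) (δ b) ⟩
  ∑ (δ a) + ∑ (δ b)                   ≡⟨ cong₂ _+_ (∑-indicator a g) (∑-indicator b g) ⟩
  g a + g b                           ∎
  where
  open ≡-Reasoning
  g : Fin n → ℕ
  g u = toℕ (f u)
  δ : Fin n → Fin n → ℕ
  δ c u = if does (u ≟ c) then g u else 0
  split : ∀ u → (if G v u then g u else 0) ≡ δ a u + δ b u
  split u with G v u | nbrs u | u ≟ a | u ≟ b
  ... | _     | _    | yes refl | yes refl = contradiction refl a≢b
  ... | true  | _    | yes _    | no _     = sym (+-identityʳ (g u))
  ... | true  | _    | no _     | yes _    = refl
  ... | true  | adj  | no u≢a   | no u≢b   with Equivalence.to adj _
  ...   | inj₁ u≡a = contradiction u≡a u≢a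
  ...   | inj₂ u≡b = contradiction u≡b u≢b
  split u | false | adj | yes u≡a | _      = ⊥-elim (Equivalence.from adj (inj₁ u≡a))
  split u | false | adj | no _    | yes u≡b = ⊥-elim (Equivalence.from adj (inj₂ u≡b))
  split u | false | _   | no _    | no _    = refl

evenIndicator : ℕ → Fin 3
evenIndicator zero          = suc zero
evenIndicator (suc zero)    = zero
evenIndicator (suc (suc k)) = evenIndicator k

isEven : ℕ → ℕ
isEven k = toℕ (evenIndicator k)

isEven-alternates : ∀ k → isEven k + isEven (suc k) ≡ 1
isEven-alternates zero          = refl
isEven-alternates (suc zero)    = refl
isEven-alternates (suc (suc k)) = isEven-alternates k

alternating-sum : ∀ m (g : ℕ → ℕ) → (∀ k → g k + g (suc k) ≡ 1) →
  ∑ {m} (λ i → g (toℕ i)) + ∑ {m} (λ i → g (toℕ i)) ≤ m + g 0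
alternating-sum zero    g alt = z≤n
alternating-sum (suc m) g alt = begin
  (g 0 + S) + (g 0 + S)      ≡⟨ double-+ (g 0) S ⟩
  (g 0 + g 0) + (S + S)      ≤⟨ +-monoʳ-≤ (g 0 + g 0) (alternating-sum m (λ k → g (suc k)) (λ k → alt (suc k))) ⟩
  (g 0 + g 0) + (m + g 1)    ≡⟨ regroup (g 0) (g 1) m ⟩
  (g 0 + g 1) + (m + g 0)    ≡⟨ cong (_+ (m + g 0)) (alt 0) ⟩
  suc m + g 0                ∎
  where
  open ≤-Reasoning
  S : ℕ
  S = ∑ {m} (λ i → g (suc (toℕ i)))
  double-+ : ∀ a b → (a + b) + (a + b) ≡ (a + a) + (b + b)
  double-+ = solve-∀
  regroup : ∀ a b m → (a + a) + (m + b) ≡ (a + b) + (m + a)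
  regroup = solve-∀

module Rotation (n : ℕ) .{{_ : NonZero n}} where

  %-absorbʳ : ∀ j x → (j + x % n) % n ≡ (j + x) % n
  %-absorbʳ j x = begin
    (j + x % n) % n          ≡⟨ %-distribˡ-+ j (x % n) n ⟩
    (j % n + x % n % n) % n  ≡⟨ cong (λ y → (j % n + y) % n) (m%n%n≡m%n x n) ⟩
    (j % n + x % n) % n      ≡⟨ %-distribˡ-+ j x n ⟨
    (j + x) % n              ∎
    where open ≡-Reasoning

  rotate : ℕ → Fin n → Fin n
  rotate k v = fromℕ< (m%n<n (k + toℕ v) n)

  toℕ-rotate : ∀ k v → toℕ (rotate k v) ≡ (k + toℕ v) % n
  toℕ-rotate k v = toℕ-fromℕ< _

  rotate-rotate : ∀ j k v → rotate j (rotate k v) ≡ rotate (j + k) v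
  rotate-rotate j k v = toℕ-injective (begin
    toℕ (rotate j (rotate k v))  ≡⟨ toℕ-rotate j _ ⟩
    (j + toℕ (rotate k v)) % n   ≡⟨ cong (λ y → (j + y) % n) (toℕ-rotate k v) ⟩
    (j + (k + toℕ v) % n) % n    ≡⟨ %-absorbʳ j (k + toℕ v) ⟩
    (j + (k + toℕ v)) % n        ≡⟨ cong (_% n) (+-assoc j k (toℕ v)) ⟨
    (j + k + toℕ v) % n          ≡⟨ toℕ-rotate (j + k) v ⟨
    toℕ (rotate (j + k) v)       ∎)
    where open ≡-Reasoning

  rotate-full : ∀ v → rotate n v ≡ v
  rotate-full v = toℕ-injective (begin
    toℕ (rotate n v)   ≡⟨ toℕ-rotate n v ⟩
    (n + toℕ v) % n    ≡⟨ cong (_% n) (+-comm n (toℕ v)) ⟩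
    (toℕ v + n) % n    ≡⟨ [m+n]%n≡m%n (toℕ v) n ⟩
    toℕ v % n          ≡⟨ m<n⇒m%n≡m (toℕ<n v) ⟩
    toℕ v              ∎)
    where open ≡-Reasoning

  -- ... while a partial turn of 0 < k < n steps moves every vertex:
  -- k + v ≡ v (mod n) would make k a multiple of n.
  rotate-≢ : ∀ {k} → 0 < k → k < n → ∀ v → rotate k v ≢ v
  rotate-≢ {k} 0<k k<n v rot≡v = not-multiple ((k + toℕ v) / n) k≡q*n
    where
    k≡q*n : k ≡ (k + toℕ v) / n * n
    k≡q*n = +-cancelʳ-≡ (toℕ v) k _ (begin
      k + toℕ v                                  ≡⟨ m≡m%n+[m/n]*n (k + toℕ v) n ⟩
      (k + toℕ v) % n + (k + toℕ v) / n * n      ≡⟨ cong (_+ (k + toℕ v) / n * n) (trans (sym (toℕ-rotate k v)) (cong toℕ rot≡v)) ⟩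
      toℕ v + (k + toℕ v) / n * n                ≡⟨ +-comm (toℕ v) _ ⟩
      (k + toℕ v) / n * n + toℕ v                ∎)
      where open ≡-Reasoning
    not-multiple : ∀ q → k ≢ q * n
    not-multiple zero    k≡0 = <⇒≢ 0<k (sym k≡0)
    not-multiple (suc q) k≡  = <⇒≱ k<n (subst (n ≤_) (sym k≡) (m≤m+n n (q * n)))

  next prev : Fin n → Fin n
  next = rotate 1
  prev = rotate (pred n)

  next-prev : ∀ v → next (prev v) ≡ v
  next-prev v = trans (rotate-rotate 1 (pred n) v)
    (trans (cong (λ k → rotate k v) (suc-pred n)) (rotate-full v))

  prev-next : ∀ v → prev (next v) ≡ v
  prev-next v = trans (rotate-rotate (pred n) 1 v)
    (trans (cong (λ k → rotate k v) (trans (+-comm (pred n) 1) (suc-pred n))) (rotate-full v))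

  next-spec : ∀ x y → T ⌊ toℕ x ℕ.≟ suc (toℕ y) % n ⌋ ⇔ x ≡ next y
  next-spec x y = mk⇔
    (λ adj → toℕ-injective (trans (toWitness adj) (sym (toℕ-rotate 1 y))))
    (λ x≡ → fromWitness (trans (cong toℕ x≡) (toℕ-rotate 1 y)))

  next⇔prev : ∀ x y → x ≡ next y ⇔ y ≡ prev x
  next⇔prev x y = mk⇔
    (λ x≡ → trans (sym (prev-next y)) (cong prev (sym x≡)))
    (λ y≡ → trans (sym (next-prev x)) (cong next (sym y≡)))

  cycle-neighbours : ∀ v u → T (Cycle n v u) ⇔ (u ≡ next v ⊎ u ≡ prev v)
  cycle-neighbours v u = (next-spec u v ⊎-⇔ (next⇔prev v u ⇔-∘ next-spec v u)) ⇔-∘ T-∨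

  -- For n ≥ 3 these neighbours differ, so the neighbourhood sum has two terms.
  nbSum-cycle : 2 < n → (f : Fn n) → ∀ v →
    nbSum (Cycle n) f v ≡ toℕ (f (next v)) + toℕ (f (prev v))
  nbSum-cycle 2<n f v = nbSum-two (Cycle n) f v next≢prev (cycle-neighbours v)
    where
    next≢prev : next v ≢ prev v
    next≢prev next≡prev = rotate-≢ (s≤s z≤n) 2<n (prev v) (begin
      rotate 2 (prev v)         ≡⟨ rotate-rotate 1 1 (prev v) ⟨
      next (next (prev v))      ≡⟨ cong next (next-prev v) ⟩
      next v                    ≡⟨ next≡prev ⟩
      prev v                    ∎)
      where open ≡-Reasoning

  ∑-nbSum-cycle : 2 < n → (f : Fn n) →
    ∑ (nbSum (Cycle n) f) ≡ weight f + weight f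
  ∑-nbSum-cycle 2<n f = begin
    ∑ (nbSum (Cycle n) f)                        ≡⟨ sum-cong-≗ (nbSum-cycle 2<n f) ⟩
    ∑ (λ v → F (next v) + F (prev v))            ≡⟨ ∑-distrib-+ (λ v → F (next v)) (λ v → F (prev v)) ⟩
    ∑ (λ v → F (next v)) + ∑ (λ v → F (prev v))  ≡⟨ cong₂ _+_ (∑-reindex next prev next-prev prev-next F)
                                                               (∑-reindex prev next prev-next next-prev F) ⟩
    weight f + weight f                          ∎
    where
    open ≡-Reasoning
    F : Fin n → ℕ
    F u = toℕ (f u)

  next-step : ∀ v → toℕ (next v) ≡ suc (toℕ v) ⊎ toℕ (next v) ≡ 0
  next-step v with m≤n⇒m<n∨m≡n (toℕ<n v)
  ... | inj₁ 1+v<n = inj₁ (trans (toℕ-rotate 1 v) (m<n⇒m%n≡m 1+v<n))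
  ... | inj₂ 1+v≡n = inj₂ (trans (toℕ-rotate 1 v) (trans (cong (_% n) 1+v≡n) (n%n≡0 n)))

module CycleDomination (n : ℕ) .{{_ : NonZero n}} (3<n : 3 < n) where
  open Rotation n

  2<n : 2 < n
  2<n = <-trans (s≤s (s≤s (s≤s z≤n))) 3<n

  alternating : Fn n
  alternating v = evenIndicator (toℕ v)

  -- Every odd position lies between two even positions (cyclically; an
  -- odd n places two even positions side by side, which is harmless).
  alternating-PID : IsPID (Cycle n) alternating
  alternating-PID v v-odd = begin
    nbSum (Cycle n) alternating v                  ≡⟨ nbSum-cycle 2<n alternating v ⟩
    isEven (toℕ (next v)) + isEven (toℕ (prev v))  ≡⟨ cong₂ _+_ (even-after (next-step v) v-odd)
                                                                (even-before prev-step v-odd) ⟩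
    2                                              ∎
    where
    open ≡-Reasoning
    prev-step : toℕ v ≡ suc (toℕ (prev v)) ⊎ toℕ v ≡ 0
    prev-step = subst (λ w → toℕ w ≡ suc (toℕ (prev v)) ⊎ toℕ w ≡ 0) (next-prev v) (next-step (prev v))
    even-after : ∀ {c d} → d ≡ suc c ⊎ d ≡ 0 → isEven c ≡ 0 → isEven d ≡ 1
    even-after {c} (inj₁ refl) c-odd = subst (λ x → x + isEven (suc c) ≡ 1) c-odd (isEven-alternates c)
    even-after (inj₂ refl) _         = refl
    even-before : ∀ {c d} → d ≡ suc c ⊎ d ≡ 0 → isEven d ≡ 0 → isEven c ≡ 1
    even-before {c} (inj₁ refl) d-odd = trans (sym (+-identityʳ (isEven c)))
      (subst (λ x → isEven c + x ≡ 1) d-odd (isEven-alternates c))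
    even-before (inj₂ refl) ()

  alternating-weight : weight alternating + weight alternating ≤ n + 1
  alternating-weight = alternating-sum n isEven isEven-alternates

  charge : Fn n → Fin n → ℕ
  charge f v = (toℕ (f v) + toℕ (f v)) + nbSum (Cycle n) f v

  charge≥2 : ∀ {f} → IsPID (Cycle n) f → ∀ v → 2 ≤ charge f v
  charge≥2 {f} pid v = bound (f v) (nbSum (Cycle n) f v) (pid v)
    where
    bound : ∀ (x : Fin 3) m → (toℕ x ≡ 0 → m ≡ 2) → 2 ≤ (toℕ x + toℕ x) + m
    bound zero             m m≡2 = ≤-reflexive (sym (m≡2 refl))
    bound (suc zero)       _ _   = s≤s (s≤s z≤n)
    bound (suc (suc zero)) _ _   = s≤s (s≤s z≤n)

  excess : Fn n → Fin n → ℕ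
  excess f v = charge f v ∸ 2

  excess-of-2 : ∀ f v → toℕ (f v) ≡ 2 → excess f v ≡ 2 + nbSum (Cycle n) f v
  excess-of-2 f v fv≡2 = cong (λ x → (x + x) + nbSum (Cycle n) f v ∸ 2) fv≡2

  charge-count : ∀ {f} → IsPID (Cycle n) f →
    (weight f + weight f) + (weight f + weight f) ≡ n * 2 + ∑ (excess f)
  charge-count {f} pid = begin
    (weight f + weight f) + (weight f + weight f)  ≡⟨ cong₂ _+_ (∑-distrib-+ F F) (∑-nbSum-cycle 2<n f) ⟨
    ∑ (λ v → F v + F v) + ∑ (nbSum (Cycle n) f)    ≡⟨ ∑-distrib-+ (λ v → F v + F v) (nbSum (Cycle n) f) ⟨
    ∑ (charge f)                                   ≡⟨ ∑-above 2 (charge f) (charge≥2 pid) ⟩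
    n * 2 + ∑ (excess f)                           ∎
    where
    open ≡-Reasoning
    F : Fin n → ℕ
    F u = toℕ (f u)

  -- A minimum-weight PID-function is no heavier than the alternating one,
  -- which leaves a total excess of at most 2.
  excess-upper : ∀ {f} → IsGammaPIDFunction (Cycle n) f → ∑ (excess f) ≤ 2
  excess-upper {f} (pid , minimal) = +-cancelˡ-≤ (n * 2) _ _ (begin
    n * 2 + ∑ (excess f)                           ≡⟨ charge-count pid ⟨
    (weight f + weight f) + (weight f + weight f)  ≤⟨ +-mono-≤ twice-w twice-w ⟩
    (n + 1) + (n + 1)                              ≡⟨ double-n n ⟩
    n * 2 + 2                                      ∎)
    where
    open ≤-Reasoning
    w≤alt : weight f ≤ weight alternating
    w≤alt = minimal alternating alternating-PID
    twice-w : weight f + weight f ≤ n + 1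
    twice-w = ≤-trans (+-mono-≤ w≤alt w≤alt) alternating-weight
    double-n : ∀ n → (n + 1) + (n + 1) ≡ n * 2 + 2
    double-n = solve-∀

  -- A 2 followed by a 0 forces the pattern 2, 0, 0, 2: the 0 after the 2
  -- is already dominated, so its other neighbour is 0, whose next
  -- neighbour must then carry 2.
  forced-two : ∀ {f} → IsPID (Cycle n) f → ∀ v → toℕ (f v) ≡ 2 →
    toℕ (f (next v)) ≡ 0 → toℕ (f (next (next (next v)))) ≡ 2
  forced-two {f} pid v fv≡2 f1≡0 = begin
    F v3                               ≡⟨ +-identityʳ (F v3) ⟨
    F v3 + 0                           ≡⟨ cong (F v3 +_) (trans (cong F (prev-next (next v))) f1≡0) ⟨
    F v3 + F (prev (next (next v)))    ≡⟨ nbSum-cycle 2<n f (next (next v)) ⟨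
    nbSum (Cycle n) f (next (next v))  ≡⟨ pid (next (next v)) f2≡0 ⟩
    2                                  ∎
    where
    open ≡-Reasoning
    F : Fin n → ℕ
    F u = toℕ (f u)
    v3 : Fin n
    v3 = next (next (next v))
    f2≡0 : F (next (next v)) ≡ 0
    f2≡0 = +-cancelʳ-≡ 2 _ 0 (begin
      F (next (next v)) + 2                   ≡⟨ cong (F (next (next v)) +_) (trans (cong F (prev-next v)) fv≡2) ⟨
      F (next (next v)) + F (prev (next v))   ≡⟨ nbSum-cycle 2<n f (next v) ⟨
      nbSum (Cycle n) f (next v)              ≡⟨ pid (next v) f1≡0 ⟩
      2                                       ∎)

  -- A vertex of value 2 creates a total excess of at least 3: either its
  -- successor is nonzero, or the forced pattern 2, 0, 0, 2 yields a second
  -- vertex of value 2, distinct from the first because n ≥ 4.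
  excess-lower : ∀ {f} → IsPID (Cycle n) f → ∀ v → toℕ (f v) ≡ 2 → 3 ≤ ∑ (excess f)
  excess-lower {f} pid v fv≡2 with toℕ (f (next v)) ℕ.≟ 0
  ... | no f1≢0 = begin
    3                               ≤⟨ +-monoʳ-≤ 2 (n≢0⇒n>0 f1≢0) ⟩
    2 + F (next v)                  ≤⟨ +-monoʳ-≤ 2 (m≤m+n (F (next v)) (F (prev v))) ⟩
    2 + (F (next v) + F (prev v))   ≡⟨ cong (2 +_) (nbSum-cycle 2<n f v) ⟨
    2 + nbSum (Cycle n) f v         ≡⟨ excess-of-2 f v fv≡2 ⟨
    excess f v                      ≤⟨ term≤∑ (excess f) v ⟩
    ∑ (excess f)                    ∎
    where
    open ≤-Reasoning
    F : Fin n → ℕ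
    F u = toℕ (f u)
  ... | yes f1≡0 = begin
    3                               ≤⟨ s≤s (s≤s (s≤s z≤n)) ⟩
    2 + 2                           ≤⟨ +-mono-≤ (two≤excess v fv≡2) (two≤excess v3 (forced-two pid v fv≡2 f1≡0)) ⟩
    excess f v + excess f v3        ≤⟨ terms≤∑ (excess f) v≢v3 ⟩
    ∑ (excess f)                    ∎
    where
    open ≤-Reasoning
    v3 : Fin n
    v3 = next (next (next v))
    two≤excess : ∀ u → toℕ (f u) ≡ 2 → 2 ≤ excess f u
    two≤excess u fu≡2 = subst (2 ≤_) (sym (excess-of-2 f u fu≡2)) (m≤m+n 2 _)
    v3≡rotate3 : v3 ≡ rotate 3 v
    v3≡rotate3 = trans (cong next (rotate-rotate 1 1 v)) (rotate-rotate 1 2 v)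
    v≢v3 : v ≢ v3
    v≢v3 v≡v3 = rotate-≢ (s≤s z≤n) 3<n v (trans (sym v3≡rotate3) (sym v≡v3))

lemma2p4 : (n : ℕ) → .{{_ : NonZero n}} → 4 ≤ n → (f : Fn n) →
    IsGammaPIDFunction (Cycle n) f → (v : Fin n) → toℕ (f v) ≢ 2
lemma2p4 n 4≤n f γ-function v fv≡2 =
  <⇒≱ (excess-lower (proj₁ γ-function) v fv≡2) (excess-upper γ-function)
  where open CycleDomination n 4≤n
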